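{- Let $n\geq 8$ and let $T$ be a tree with $n$ vertices that has a pendant star $K_{1,3}$. Then $\Psi(T)$ is not minimum over all trees with $n$ vertices, i.e. there is a tree $T'$ with $n$ vertices with $\Psi(T')<\Psi(T)$.
   Context: A matching of a graph is a set of edges no two of which share a vertex; it is maximal if it is not properly contained in another matching. $\Psi(G)$ denotes the number of maximal matchings of $G$. For a connected graph $G$ not isomorphic to a star, a pendant star with $t$ rays ($t\ge3$) in $G$ is a subgraph isomorphic to $K_{1,t}$ such that $t-1$ of its leaves are leaves (degree-$1$ vertices) of $G$ and its central vertex has degree $t$ in $G$. -}

module Defs where

open import Data.Nat using (ℕ; zero; suc; _≤_; _<_)
open import Data.Bool using (Bool; true; false)
import Data.Bool as Bool
open import Data.Fin using (Fin)
import Data.Fin as Fin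
open import Data.Fin.Properties using (all?)
open import Data.Vec using (Vec; []; _∷_; lookup)
open import Data.List using (List; []; _∷_; [_]; map; concatMap; length; filter; allFin; _∷ʳ_)
open import Data.List.Membership.Propositional using (_∈_)
open import Data.List.Membership.Propositional.Properties using (∈-map⁺; ∈-concatMap⁺)
import Data.List.Relation.Unary.Any as Any
open import Data.List.Relation.Unary.All using (All)
import Data.List.Relation.Unary.All as All
open import Data.List.Relation.Unary.Unique.Propositional using (Unique)
open import Data.List.Relation.Unary.Linked using (Linked)
open import Data.Product using (Σ; ∃; _×_; _,_)
open import Relation.Binary.PropositionalEquality using (_≡_; refl)
open import Relation.Nullary using (Dec; yes; no; ¬_)
open import Relation.Nullary.Decidable using (_×-dec_; _→-dec_)

record Graph (n : ℕ) : Set where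
  field
    adj    : Fin n → Fin n → Bool
    sym    : ∀ i j → adj i j ≡ adj j i
    irrefl : ∀ i → adj i i ≡ false

Adj : ∀ {n} → Graph n → Fin n → Fin n → Set
Adj G i j = Graph.adj G i j ≡ true

deg : ∀ {n} → Graph n → Fin n → ℕ
deg {n} G v = length (filter (λ u → Graph.adj G v u Bool.≟ true) (allFin n))

data Walk {n} (G : Graph n) : Fin n → Fin n → Set where
  here : ∀ {v} → Walk G v v
  step : ∀ {u v w} → Adj G u v → Walk G v w → Walk G u w

Connected : ∀ {n} → Graph n → Set
Connected {n} G = ∀ (u v : Fin n) → Walk G u v

-- a cycle v ∷ ws : at least 3 distinct vertices, consecutive ones adjacent,
-- and the last one adjacent to the first one v
IsCycle : ∀ {n} → Graph n → Fin n → List (Fin n) → Set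
IsCycle G v ws = (2 ≤ length ws) × Unique (v ∷ ws) × Linked (Adj G) ((v ∷ ws) ∷ʳ v)

Acyclic : ∀ {n} → Graph n → Set
Acyclic {n} G = ∀ (v : Fin n) (ws : List (Fin n)) → ¬ IsCycle G v ws

IsTree : ∀ {n} → Graph n → Set
IsTree G = Connected G × Acyclic G

EdgeSet : ℕ → Set
EdgeSet n = Vec (Vec Bool n) n

_∋[_,_] : ∀ {n} → EdgeSet n → Fin n → Fin n → Set
M ∋[ i , j ] = lookup (lookup M i) j ≡ true

_⊆ₑ_ : ∀ {n} → EdgeSet n → EdgeSet n → Set
_⊆ₑ_ {n} M M' = ∀ (i j : Fin n) → M ∋[ i , j ] → M' ∋[ i , j ]

IsMatching : ∀ {n} → Graph n → EdgeSet n → Set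
IsMatching {n} G M =
    (∀ (i j : Fin n) → M ∋[ i , j ] → M ∋[ j , i ])
  × (∀ (i j : Fin n) → M ∋[ i , j ] → Adj G i j)
  × (∀ (i j k : Fin n) → M ∋[ i , j ] → M ∋[ i , k ] → j ≡ k)

IsMaximalMatching : ∀ {n} → Graph n → EdgeSet n → Set
IsMaximalMatching {n} G M =
  IsMatching G M × (∀ (M' : EdgeSet n) → IsMatching G M' → M ⊆ₑ M' → M' ⊆ₑ M)

allVec : ∀ {A : Set} → List A → (k : ℕ) → List (Vec A k)
allVec xs zero    = [ [] ]
allVec xs (suc k) = concatMap (λ x → map (x ∷_) (allVec xs k)) xs

allVec-complete : ∀ {A : Set} (xs : List A) → (∀ x → x ∈ xs) →
                  ∀ k (v : Vec A k) → v ∈ allVec xs k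
allVec-complete xs c zero [] = Any.here refl
allVec-complete xs c (suc k) (x ∷ v) =
  ∈-concatMap⁺ (λ y → map (y ∷_) (allVec xs k)) (Any.map (λ { refl → ∈-map⁺ (x ∷_) (allVec-complete xs c k v) }) (c x))

bools : List Bool
bools = true ∷ false ∷ []

bools-complete : ∀ b → b ∈ bools
bools-complete true  = Any.here refl
bools-complete false = Any.there (Any.here refl)

allEdgeSets : (n : ℕ) → List (EdgeSet n)
allEdgeSets n = allVec (allVec bools n) n

allEdgeSets-complete : ∀ n (M : EdgeSet n) → M ∈ allEdgeSets n
allEdgeSets-complete n = allVec-complete _ (allVec-complete bools bools-complete n) n

_∋?[_,_] : ∀ {n} (M : EdgeSet n) i j → Dec (M ∋[ i , j ])
M ∋?[ i , j ] = lookup (lookup M i) j Bool.≟ true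

isMatching? : ∀ {n} (G : Graph n) (M : EdgeSet n) → Dec (IsMatching G M)
isMatching? G M =
      all? (λ i → all? (λ j → (M ∋?[ i , j ]) →-dec (M ∋?[ j , i ])))
  ×-dec all? (λ i → all? (λ j → (M ∋?[ i , j ]) →-dec (Graph.adj G i j Bool.≟ true)))
  ×-dec all? (λ i → all? (λ j → all? (λ k →
          (M ∋?[ i , j ]) →-dec ((M ∋?[ i , k ]) →-dec (j Fin.≟ k)))))

⊆ₑ? : ∀ {n} (M M' : EdgeSet n) → Dec (M ⊆ₑ M')
⊆ₑ? M M' = all? (λ i → all? (λ j → (M ∋?[ i , j ]) →-dec (M' ∋?[ i , j ])))

isMaximalMatching? : ∀ {n} (G : Graph n) (M : EdgeSet n) → Dec (IsMaximalMatching G M)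
isMaximalMatching? {n} G M = isMatching? G M ×-dec forall?
  where
  P : EdgeSet n → Set
  P M' = IsMatching G M' → M ⊆ₑ M' → M' ⊆ₑ M
  forall? : Dec (∀ M' → P M')
  forall? with All.all? (λ M' → isMatching? G M' →-dec (⊆ₑ? M M' →-dec ⊆ₑ? M' M)) (allEdgeSets n)
  ... | yes a = yes (λ M' → All.lookup a (allEdgeSets-complete n M'))
  ... | no ¬a = no (λ h → ¬a (All.tabulate (λ {M'} _ → h M')))

Ψ : ∀ {n} → Graph n → ℕ
Ψ {n} G = length (filter (isMaximalMatching? G) (allEdgeSets n))

-- Pendant star K_{1,3}: a centre c of degree 3 in G with three distinct
-- neighbours a, b, d, of which (at least) a and b are leaves of G.

HasPendantStar3 : ∀ {n} → Graph n → Set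
HasPendantStar3 {n} G =
  Σ (Fin n) λ c → Σ (Fin n) λ a → Σ (Fin n) λ b → Σ (Fin n) λ d →
      Adj G c a × Adj G c b × Adj G c d
    × ¬ (a ≡ b) × ¬ (a ≡ d) × ¬ (b ≡ d)
    × deg G c ≡ 3 × deg G a ≡ 1 × deg G b ≡ 1

module Submission where

open import Defs
open import Data.Nat using (ℕ; zero; suc; _≤_; _<_; z≤n; s≤s)
import Data.Nat as ℕ
open import Data.Nat.Properties using (≤-trans; ≤-antisym; <⇒≱; m≤m+n)
open import Data.Product using (Σ; _×_; _,_; proj₁; proj₂)
open import Data.Sum using (_⊎_; inj₁; inj₂; [_,_])
import Data.Sum
open import Data.Empty using (⊥; ⊥-elim)
open import Data.Bool using (Bool; true; false; _∨_; _∧_; not)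
import Data.Bool as Bool
open import Data.Bool.Properties using (⇔→≡)
open import Data.Fin using (Fin; _≟_)
import Data.Fin.Properties as Finₚ
open import Data.Vec using (Vec; _∷_; lookup; tabulate)
import Data.Vec.Properties as Vecₚ
open import Data.List
  using (List; []; _∷_; _++_; _∷ʳ_; map; length; filter; allFin; concatMap; cartesianProduct; cartesianProductWith)
import Data.List.Properties as Listₚ
open import Data.List.Membership.Propositional using (_∈_; _∉_)
open import Data.List.Membership.Propositional.Properties
  using (∈-filter⁺; ∈-filter⁻; ∈-map⁺; ∈-map⁻; ∈-allFin; ∈-cartesianProduct⁺; ∈-∃++; ∈-++⁺ˡ; ∈-++⁺ʳ)
import Data.List.Membership.DecPropositional as DecMembership
open import Data.List.Relation.Binary.Subset.Propositional using (_⊆_)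
open import Data.List.Relation.Unary.Any as Any using (here; there)
open import Data.List.Relation.Unary.All as All using (All; []; _∷_)
open import Data.List.Relation.Unary.All.Properties using (¬Any⇒All¬; All¬⇒¬Any; ∷ʳ⁺)
import Data.List.Relation.Unary.All.Properties as Allₚ
open import Data.List.Relation.Unary.Linked using (Linked; []; [-]; _∷_)
open import Data.List.Relation.Unary.Unique.Propositional using (Unique; []; _∷_)
import Data.List.Relation.Unary.Unique.Propositional.Properties as Uniqueₚ
open import Function using (id; _∘_; case_of_)
open import Function.Bundles using (mk⇔)
open import Relation.Binary using (DecidableEquality)
open import Relation.Binary.PropositionalEquality
  using (_≡_; _≢_; refl; sym; trans; subst; cong; module ≡-Reasoning)
open import Relation.Nullary using (Dec; yes; no; ¬_; ¬?; does)
open import Relation.Nullary.Decidable using (_×-dec_; _⊎-dec_; decidable-stable)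

open ≡-Reasoning

-- Let c be the centre of the pendant star, a and b its leaves, d its third neighbour, and T' the tree
-- obtained by moving the leaf b from c to d. A maximal matching M of T' yields one of T: M itself if
-- db ∉ M; otherwise ca ∈ M (c must be matched), and db, ca are traded for cb, dy with y a free
-- neighbour of d, or db is simply dropped if there is no such y. The three cases are told apart by cb
-- and by whether d or b is matched, and within each case M can be read back, so this is an injection.
-- It misses every maximal matching of T that contains cb and leaves d free, and every one that
-- contains cb and de while leaving free a neighbour p ≠ e of d preferred by the swap. A greedy
-- construction yields a matching of one of these two kinds; acyclicity of T is what keeps p free.

module _ {A : Set} (_≟_ : DecidableEquality A) where

  Unique-⊆⇒length≤ : ∀ {xs ys : List A} → Unique xs → xs ⊆ ys → length xs ≤ length ys
  Unique-⊆⇒length≤ {[]} _ _ = z≤n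
  Unique-⊆⇒length≤ {x ∷ xs} {ys} (x∉xs ∷ u) xs⊆ys =
    ≤-trans (s≤s (Unique-⊆⇒length≤ u xs⊆ys-x)) (Listₚ.filter-notAll ≢x? ys x∈ys)
    where
    ≢x? : ∀ z → Dec (z ≢ x)
    ≢x? z = ¬? (z ≟ x)
    x∈ys : Any.Any (λ z → ¬ z ≢ x) ys
    x∈ys = Any.map (λ x≡z z≢x → z≢x (sym x≡z)) (xs⊆ys (here refl))
    xs⊆ys-x : xs ⊆ filter ≢x? ys
    xs⊆ys-x z∈xs = ∈-filter⁺ ≢x? (xs⊆ys (there z∈xs)) λ { refl → All¬⇒¬Any x∉xs z∈xs }

  Unique-⊆-∌⇒length< : ∀ {xs ys : List A} {w} → Unique xs → xs ⊆ ys → w ∈ ys → w ∉ xs →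
                        length xs < length ys
  Unique-⊆-∌⇒length< {xs} u xs⊆ys w∈ys w∉xs =
    Unique-⊆⇒length≤ (¬Any⇒All¬ xs w∉xs ∷ u) λ { (here refl) → w∈ys ; (there z∈xs) → xs⊆ys z∈xs }

map⁺-injectiveOn : ∀ {A B : Set} {f : A → B} {xs} → (∀ {x y} → x ∈ xs → y ∈ xs → f x ≡ f y → x ≡ y) →
          Unique xs → Unique (map f xs)
map⁺-injectiveOn {xs = []} _ [] = []
map⁺-injectiveOn {xs = x ∷ xs} inj (x∉xs ∷ u) =
  Allₚ.map⁺ (All.tabulate λ y∈xs fx≡fy → All.lookup x∉xs y∈xs (inj (here refl) (there y∈xs) fx≡fy))
  ∷ map⁺-injectiveOn (λ p q → inj (there p) (there q)) u

allVec-unique : ∀ {A : Set} {xs : List A} → Unique xs → ∀ k → Unique (allVec xs k)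
allVec-unique u zero    = [] ∷ []
allVec-unique {xs = xs} u (suc k) = subst Unique (sym (concatMap≡cartesianProduct xs))
  (Uniqueₚ.cartesianProductWith⁺ _∷_ Vecₚ.∷-injective u (allVec-unique u k))
  where
  concatMap≡cartesianProduct : ∀ zs → concatMap (λ z → map (z ∷_) (allVec xs k)) zs ≡
                                     cartesianProductWith _∷_ zs (allVec xs k)
  concatMap≡cartesianProduct [] = refl
  concatMap≡cartesianProduct (z ∷ zs) =
    cong (map (z ∷_) (allVec xs k) ++_) (concatMap≡cartesianProduct zs)

allEdgeSets-unique : ∀ n → Unique (allEdgeSets n)
allEdgeSets-unique n = allVec-unique (allVec-unique bools-unique n) n
  where
  bools-unique : Unique bools
  bools-unique = ((λ ()) ∷ []) ∷ [] ∷ []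

Ψ<Ψ-by-injection : ∀ {n} {G G' : Graph n} (φ : EdgeSet n → EdgeSet n) →
  (∀ M → IsMaximalMatching G' M → IsMaximalMatching G (φ M)) →
  (∀ {M M'} → IsMaximalMatching G' M → IsMaximalMatching G' M' → φ M ≡ φ M' → M ≡ M') →
  (W : EdgeSet n) → IsMaximalMatching G W → (∀ M → IsMaximalMatching G' M → φ M ≢ W) →
  Ψ G' < Ψ G
Ψ<Ψ-by-injection {n} {G} {G'} φ φ-max φ-inj W W-max W∉φ =
  subst (_< Ψ G) (Listₚ.length-map φ maxG')
    (Unique-⊆-∌⇒length< _≟ₑ_ (map⁺-injectiveOn (λ p q → φ-inj (max' p) (max' q)) maxG'-unique)
                             image⊆ (∈maxG W-max) W∉image)
  where
  _≟ₑ_ : DecidableEquality (EdgeSet n)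
  _≟ₑ_ = Vecₚ.≡-dec (Vecₚ.≡-dec Bool._≟_)
  maxG maxG' : List (EdgeSet n)
  maxG  = filter (isMaximalMatching? G) (allEdgeSets n)
  maxG' = filter (isMaximalMatching? G') (allEdgeSets n)
  maxG'-unique : Unique maxG'
  maxG'-unique = Uniqueₚ.filter⁺ (isMaximalMatching? G') (allEdgeSets-unique n)
  max' : ∀ {M} → M ∈ maxG' → IsMaximalMatching G' M
  max' M∈ = proj₂ (∈-filter⁻ (isMaximalMatching? G') {xs = allEdgeSets n} M∈)
  ∈maxG : ∀ {M} → IsMaximalMatching G M → M ∈ maxG
  ∈maxG {M} = ∈-filter⁺ (isMaximalMatching? G) (allEdgeSets-complete n M)
  image⊆ : map φ maxG' ⊆ maxG
  image⊆ φM∈ with ∈-map⁻ φ φM∈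
  ... | M , M∈ , refl = ∈maxG (φ-max M (max' M∈))
  W∉image : W ∉ map φ maxG'
  W∉image W∈ with ∈-map⁻ φ W∈
  ... | M , M∈ , W≡φM = W∉φ M (max' M∈) (sym W≡φM)

module _ {A : Set} where

  Unique-++⇒disjoint : ∀ (xs : List A) {ys x} → Unique (xs ++ ys) → x ∈ xs → x ∉ ys
  Unique-++⇒disjoint (_ ∷ xs) u (here refl) x∈ys = Uniqueₚ.Unique[x∷xs]⇒x∉xs u (∈-++⁺ʳ xs x∈ys)
  Unique-++⇒disjoint (_ ∷ xs) (_ ∷ u) (there x∈xs) = Unique-++⇒disjoint xs u x∈xs

module _ {A : Set} {R : A → A → Set} where

  Linked-predecessor : ∀ x pre {y zs} → Linked R (x ∷ pre ++ y ∷ zs) →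
                       Σ A λ p → R p y × (pre ≡ [] × p ≡ x ⊎ p ∈ pre)
  Linked-predecessor x []        (r ∷ _) = x , r , inj₁ (refl , refl)
  Linked-predecessor x (x' ∷ pre) (_ ∷ l) with Linked-predecessor x' pre l
  ... | p , r , inj₁ (refl , refl) = p , r , inj₂ (here refl)
  ... | p , r , inj₂ p∈pre         = p , r , inj₂ (there p∈pre)

  Linked-suffix : ∀ xs {ys} → Linked R (xs ++ ys) → Linked R ys
  Linked-suffix []            l       = l
  Linked-suffix (_ ∷ [])      {[]} _  = []
  Linked-suffix (_ ∷ [])      {_ ∷ _} (_ ∷ l) = l
  Linked-suffix (_ ∷ x ∷ xs)  (_ ∷ l) = Linked-suffix (x ∷ xs) l

module Graphs {n : ℕ} (G : Graph n) where

  adj⇒≢ : ∀ {x y} → Adj G x y → x ≢ y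
  adj⇒≢ {x} xy refl with trans (sym xy) (Graph.irrefl G x)
  ... | ()

  adj-sym : ∀ {x y} → Adj G x y → Adj G y x
  adj-sym {x} {y} xy = trans (Graph.sym G y x) xy

  -- the two cycle neighbours of b would both be d
  leaf∉cycle : ∀ {b d} → (∀ {y} → Adj G b y → y ≡ d) → ∀ {v ws} → IsCycle G v ws → b ∉ v ∷ ws
  leaf∉cycle _    {ws = _ ∷ []} (s≤s () , _) _
  leaf∉cycle leaf {ws = w₁ ∷ w₂ ∷ ws} (_ , u , bw₁ ∷ l) (here refl)
    with Linked-predecessor w₁ (w₂ ∷ ws) l
  ... | _ , _  , inj₁ (() , _)
  ... | p , pb , inj₂ p∈ws with trans (leaf (adj-sym pb)) (sym (leaf bw₁))
  ...   | refl = Uniqueₚ.Unique[x∷xs]⇒x∉xs (Uniqueₚ.drop⁺ 1 u) p∈ws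
  leaf∉cycle {b} leaf {v} (2≤ , u , l) (there b∈ws) with ∈-∃++ b∈ws
  ... | pre , post , refl =
    interior post 2≤ u (subst (Linked (Adj G)) (cong (v ∷_) (Listₚ.++-assoc pre (b ∷ post) (v ∷ []))) l)
    where
    interior : ∀ post → 2 ≤ length (pre ++ b ∷ post) → Unique (v ∷ pre ++ b ∷ post) →
               Linked (Adj G) (v ∷ pre ++ b ∷ (post ∷ʳ v)) → ⊥
    interior post 2≤ u l with Linked-predecessor v pre l | Linked-suffix (v ∷ pre) l
    interior [] 2≤ u l | p , pb , p-pos | bv ∷ _ with trans (leaf (adj-sym pb)) (sym (leaf bv)) | p-pos
    ... | refl | inj₁ (refl , _) with 2≤
    ...   | s≤s ()
    interior [] 2≤ u l | p , pb , p-pos | bv ∷ _ | refl | inj₂ v∈pre =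
      Uniqueₚ.Unique[x∷xs]⇒x∉xs u (∈-++⁺ˡ v∈pre)
    interior (q ∷ post) 2≤ u l | p , pb , p-pos | bq ∷ _
      with trans (leaf (adj-sym pb)) (sym (leaf bq)) | p-pos
    ... | refl | inj₁ (_ , refl) = Uniqueₚ.Unique[x∷xs]⇒x∉xs u (∈-++⁺ʳ pre (there (here refl)))
    ... | refl | inj₂ q∈pre      = Unique-++⇒disjoint pre (Uniqueₚ.drop⁺ 1 u) q∈pre (there (here refl))

  neighbours : Fin n → List (Fin n)
  neighbours v = filter (λ u → Graph.adj G v u Bool.≟ true) (allFin n)

  ∈-neighbours⁺ : ∀ {v x} → Adj G v x → x ∈ neighbours v
  ∈-neighbours⁺ {x = x} vx = ∈-filter⁺ _ (∈-allFin x) vx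

  ∈-neighbours⁻ : ∀ {v x} → x ∈ neighbours v → Adj G v x
  ∈-neighbours⁻ x∈ = proj₂ (∈-filter⁻ _ {xs = allFin n} x∈)

  Unique-neighbours⇒length≤deg : ∀ {v xs} → Unique xs → (∀ {x} → x ∈ xs → Adj G v x) →
                                 length xs ≤ deg G v
  Unique-neighbours⇒length≤deg u adj = Unique-⊆⇒length≤ _≟_ u (λ x∈ → ∈-neighbours⁺ (adj x∈))

  deg≡1⇒neighbour-unique : ∀ {v x y} → deg G v ≡ 1 → Adj G v x → Adj G v y → x ≡ y
  deg≡1⇒neighbour-unique {v} {x} {y} deg≡1 vx vy with x ≟ y
  ... | yes x≡y = x≡y
  ... | no x≢y with subst (2 ≤_) deg≡1 (Unique-neighbours⇒length≤deg ((x≢y ∷ []) ∷ [] ∷ [])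
                                         λ { (here refl) → vx ; (there (here refl)) → vy })
  ...   | s≤s ()

  deg≡3⇒neighbours : ∀ {v a b d y} → deg G v ≡ 3 → Adj G v a → Adj G v b → Adj G v d →
                     a ≢ b → a ≢ d → b ≢ d → Adj G v y → y ≡ a ⊎ y ≡ b ⊎ y ≡ d
  deg≡3⇒neighbours {v} {a} {b} {d} {y} deg≡3 va vb vd a≢b a≢d b≢d vy with y ≟ a | y ≟ b | y ≟ d
  ... | yes y≡a | _       | _       = inj₁ y≡a
  ... | no _    | yes y≡b | _       = inj₂ (inj₁ y≡b)
  ... | no _    | no _    | yes y≡d = inj₂ (inj₂ y≡d)
  ... | no y≢a  | no y≢b  | no y≢d
    with subst (4 ≤_) deg≡3 (Unique-neighbours⇒length≤deg
           ((y≢a ∷ y≢b ∷ y≢d ∷ []) ∷ (a≢b ∷ a≢d ∷ []) ∷ (b≢d ∷ []) ∷ [] ∷ [])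
           λ { (here refl) → vy ; (there (here refl)) → va ; (there (there (here refl))) → vb
             ; (there (there (there (here refl)))) → vd })
  ...   | s≤s (s≤s (s≤s ()))

  deg≢1⇒another-neighbour : ∀ {v x} → deg G v ≢ 1 → Adj G v x → Σ (Fin n) λ y → Adj G v y × y ≢ x
  deg≢1⇒another-neighbour {v} {x} deg≢1 vx
    with Finₚ.any? (λ y → (Graph.adj G v y Bool.≟ true) ×-dec ¬? (y ≟ x))
  ... | yes other = other
  ... | no ¬other = ⊥-elim (deg≢1 (≤-antisym deg≤1 1≤deg))
    where
    deg≤1 : deg G v ≤ 1
    deg≤1 = Unique-⊆⇒length≤ _≟_ {ys = x ∷ []} (Uniqueₚ.filter⁺ _ (Uniqueₚ.allFin⁺ n)) λ {y} y∈ →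
      case y ≟ x of λ { (yes refl) → here refl ; (no y≢x) → ⊥-elim (¬other (y , ∈-neighbours⁻ y∈ , y≢x)) }
    1≤deg : 1 ≤ deg G v
    1≤deg = Unique-neighbours⇒length≤deg ([] ∷ []) λ { (here refl) → vx }

  walk-exits : (S : Fin n → Set) → (∀ x → Dec (S x)) → ∀ {u v} → Walk G u v → S u → ¬ S v →
               Σ (Fin n) λ x → Σ (Fin n) λ y → S x × ¬ S y × Adj G x y
  walk-exits S S? here su ¬sv = ⊥-elim (¬sv su)
  walk-exits S S? (step {u} {w} uw w⇝v) su ¬sv with S? w
  ... | yes sw = walk-exits S S? w⇝v sw ¬sv
  ... | no ¬sw = u , w , su , ¬sw , uw

  triangle-free : Acyclic G → ∀ {x y z} → Adj G x y → Adj G y z → Adj G z x → ⊥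
  triangle-free acyclic {x} {y} {z} xy yz zx =
    acyclic x (y ∷ z ∷ []) ( s≤s (s≤s z≤n)
                           , ((adj⇒≢ xy ∷ adj⇒≢ (adj-sym zx) ∷ []) ∷ (adj⇒≢ yz ∷ []) ∷ [] ∷ [])
                           , xy ∷ yz ∷ zx ∷ [-])

  square-free : Acyclic G → ∀ {x y z w} → Adj G x y → Adj G y z → Adj G z w → Adj G w x →
                x ≢ z → y ≢ w → ⊥
  square-free acyclic {x} {y} {z} {w} xy yz zw wx x≢z y≢w =
    acyclic x (y ∷ z ∷ w ∷ []) ( s≤s (s≤s z≤n)
                               , ( (adj⇒≢ xy ∷ x≢z ∷ adj⇒≢ (adj-sym wx) ∷ [])
                                 ∷ (adj⇒≢ yz ∷ y≢w ∷ []) ∷ (adj⇒≢ zw ∷ []) ∷ [] ∷ [])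
                               , xy ∷ yz ∷ zw ∷ wx ∷ [-])

∃∉ : ∀ {n} (L : List (Fin n)) → length L < n → Σ (Fin n) (_∉ L)
∃∉ {n} L |L|<n = decidable-stable (Finₚ.any? λ v → ¬? (v ∈? L)) ¬¬∃∉
  where
  open DecMembership (_≟_ {n}) using (_∈?_)
  ¬¬∃∉ : ¬ ¬ Σ (Fin n) (_∉ L)
  ¬¬∃∉ ¬∃∉ = <⇒≱ |L|<n (subst (_≤ length L) (Listₚ.length-tabulate id)
    (Unique-⊆⇒length≤ _≟_ (Uniqueₚ.allFin⁺ n) λ {v} _ → decidable-stable (v ∈? L) λ v∉L → ¬∃∉ (v , v∉L)))

module EdgeSets {n : ℕ} where

  entry : EdgeSet n → Fin n → Fin n → Bool
  entry M i j = lookup (lookup M i) j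

  fromFun : (Fin n → Fin n → Bool) → EdgeSet n
  fromFun f = tabulate (λ i → tabulate (f i))

  entry-fromFun : ∀ f i j → entry (fromFun f) i j ≡ f i j
  entry-fromFun f i j
    rewrite Vecₚ.lookup∘tabulate (λ i → tabulate (f i)) i = Vecₚ.lookup∘tabulate (f i) j

  ∋-ext : ∀ {M M' : EdgeSet n} → (∀ i j → M ∋[ i , j ] → M' ∋[ i , j ]) →
          (∀ i j → M' ∋[ i , j ] → M ∋[ i , j ]) → M ≡ M'
  ∋-ext to from = lookup-ext λ i → lookup-ext λ j → ⇔→≡ (mk⇔ (to i j) (from i j))
    where
    lookup-ext : ∀ {A : Set} {xs ys : Vec A n} → (∀ i → lookup xs i ≡ lookup ys i) → xs ≡ ys
    lookup-ext {xs = xs} {ys} eq =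
      trans (sym (Vecₚ.tabulate∘lookup xs)) (trans (Vecₚ.tabulate-cong eq) (Vecₚ.tabulate∘lookup ys))

  SameEdge : Fin n → Fin n → Fin n → Fin n → Set
  SameEdge u v i j = (i ≡ u × j ≡ v) ⊎ (i ≡ v × j ≡ u)

  sameEdge? : ∀ u v i j → Dec (SameEdge u v i j)
  sameEdge? u v i j = (i ≟ u ×-dec j ≟ v) ⊎-dec (i ≟ v ×-dec j ≟ u)

  SameEdge-sym : ∀ {u v i j} → SameEdge u v i j → SameEdge u v j i
  SameEdge-sym (inj₁ (i≡u , j≡v)) = inj₂ (j≡v , i≡u)
  SameEdge-sym (inj₂ (i≡v , j≡u)) = inj₁ (j≡u , i≡v)

  ¬SameEdgeˡ : ∀ {u v i j} → i ≢ u → i ≢ v → ¬ SameEdge u v i j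
  ¬SameEdgeˡ i≢u _ (inj₁ (i≡u , _)) = i≢u i≡u
  ¬SameEdgeˡ _ i≢v (inj₂ (i≡v , _)) = i≢v i≡v

  ¬SameEdgeʳ : ∀ {u v i j} → j ≢ u → j ≢ v → ¬ SameEdge u v i j
  ¬SameEdgeʳ _ j≢v (inj₁ (_ , j≡v)) = j≢v j≡v
  ¬SameEdgeʳ j≢u _ (inj₂ (_ , j≡u)) = j≢u j≡u

  insert : Fin n → Fin n → EdgeSet n → EdgeSet n
  insert u v M = fromFun (λ i j → does (sameEdge? u v i j) ∨ entry M i j)

  remove : Fin n → Fin n → EdgeSet n → EdgeSet n
  remove u v M = fromFun (λ i j → not (does (sameEdge? u v i j)) ∧ entry M i j)

  private
    module _ {P : Set} {b : Bool} where
      does∨≡true⁻ : (p? : Dec P) → does p? ∨ b ≡ true → P ⊎ b ≡ true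
      does∨≡true⁻ (yes p) _ = inj₁ p
      does∨≡true⁻ (no _) e  = inj₂ e

      does∨≡true⁺ˡ : (p? : Dec P) → P → does p? ∨ b ≡ true
      does∨≡true⁺ˡ (yes _) _ = refl
      does∨≡true⁺ˡ (no ¬p) p = ⊥-elim (¬p p)

      does∨≡true⁺ʳ : (p? : Dec P) → b ≡ true → does p? ∨ b ≡ true
      does∨≡true⁺ʳ (yes _) _ = refl
      does∨≡true⁺ʳ (no _) e  = e

      notDoes∧≡true⁻ : (p? : Dec P) → not (does p?) ∧ b ≡ true → ¬ P × b ≡ true
      notDoes∧≡true⁻ (yes _) ()
      notDoes∧≡true⁻ (no ¬p) e = ¬p , e

      notDoes∧≡true⁺ : (p? : Dec P) → ¬ P → b ≡ true → not (does p?) ∧ b ≡ true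
      notDoes∧≡true⁺ (yes p) ¬p _ = ⊥-elim (¬p p)
      notDoes∧≡true⁺ (no _) _ e   = e

  module _ (u v : Fin n) (M : EdgeSet n) {i j : Fin n} where

    ∈-insert⁻ : insert u v M ∋[ i , j ] → SameEdge u v i j ⊎ M ∋[ i , j ]
    ∈-insert⁻ h = does∨≡true⁻ (sameEdge? u v i j) (trans (sym (entry-fromFun _ i j)) h)

    ∈-insert⁺ˡ : SameEdge u v i j → insert u v M ∋[ i , j ]
    ∈-insert⁺ˡ e = trans (entry-fromFun _ i j) (does∨≡true⁺ˡ (sameEdge? u v i j) e)

    ∈-insert⁺ʳ : M ∋[ i , j ] → insert u v M ∋[ i , j ]
    ∈-insert⁺ʳ m = trans (entry-fromFun _ i j) (does∨≡true⁺ʳ (sameEdge? u v i j) m)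

    ∈-remove⁻ : remove u v M ∋[ i , j ] → ¬ SameEdge u v i j × M ∋[ i , j ]
    ∈-remove⁻ h = notDoes∧≡true⁻ (sameEdge? u v i j) (trans (sym (entry-fromFun _ i j)) h)

    ∈-remove⁺ : ¬ SameEdge u v i j → M ∋[ i , j ] → remove u v M ∋[ i , j ]
    ∈-remove⁺ ¬e m = trans (entry-fromFun _ i j) (notDoes∧≡true⁺ (sameEdge? u v i j) ¬e m)

  insert-remove : ∀ u v M → M ∋[ u , v ] → M ∋[ v , u ] → insert u v (remove u v M) ≡ M
  insert-remove u v M uv vu = ∋-ext
    (λ i j h → [ (λ { (inj₁ (refl , refl)) → uv ; (inj₂ (refl , refl)) → vu })
               , (λ h' → proj₂ (∈-remove⁻ u v M h')) ] (∈-insert⁻ u v (remove u v M) h))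
    (λ i j h → case sameEdge? u v i j of λ
      { (yes e) → ∈-insert⁺ˡ u v (remove u v M) e
      ; (no ¬e) → ∈-insert⁺ʳ u v (remove u v M) (∈-remove⁺ u v M ¬e h) })

  remove-insert : ∀ u v M → ¬ M ∋[ u , v ] → ¬ M ∋[ v , u ] → remove u v (insert u v M) ≡ M
  remove-insert u v M ¬uv ¬vu = ∋-ext
    (λ i j h → let ¬e , h' = ∈-remove⁻ u v (insert u v M) h in
               [ (λ e → ⊥-elim (¬e e)) , id ] (∈-insert⁻ u v M h'))
    (λ i j h → ∈-remove⁺ u v (insert u v M)
                 (λ { (inj₁ (refl , refl)) → ¬uv h ; (inj₂ (refl , refl)) → ¬vu h })
                 (∈-insert⁺ʳ u v M h))

  ∅ : EdgeSet n
  ∅ = fromFun (λ _ _ → false)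

  ∉-∅ : ∀ i j → ¬ (∅ ∋[ i , j ])
  ∉-∅ i j h with trans (sym (entry-fromFun _ i j)) h
  ... | ()

open EdgeSets

Covered : ∀ {n} → EdgeSet n → Fin n → Set
Covered {n} M i = Σ (Fin n) λ j → M ∋[ i , j ]

covered? : ∀ {n} (M : EdgeSet n) i → Dec (Covered M i)
covered? M i = Finₚ.any? (λ j → M ∋?[ i , j ])

Covered-insert : ∀ {n} u v (M : EdgeSet n) {i} → Covered M i → Covered (insert u v M) i
Covered-insert u v M (k , m) = k , ∈-insert⁺ʳ u v M m

Covered-remove : ∀ {n} u v (M : EdgeSet n) {i} → Covered M i → i ≢ u → i ≢ v → Covered (remove u v M) i
Covered-remove u v M (k , m) i≢u i≢v = k , ∈-remove⁺ u v M (¬SameEdgeˡ i≢u i≢v) m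

Dominating : ∀ {n} → Graph n → EdgeSet n → Set
Dominating G M = ∀ i j → Adj G i j → Covered M i ⊎ Covered M j

module Matchings {n : ℕ} (G : Graph n) where

  open Graphs G using (adj⇒≢; adj-sym)

  IsMatching-transfer : ∀ {G' : Graph n} M → IsMatching G' M → (∀ i j → M ∋[ i , j ] → Adj G i j) →
                        IsMatching G M
  IsMatching-transfer _ (sym , _ , functional) inG = sym , inG , functional

  ∅-isMatching : IsMatching G ∅
  ∅-isMatching =
    (λ i j h → ⊥-elim (∉-∅ i j h)) , (λ i j h → ⊥-elim (∉-∅ i j h)) , (λ i j _ h → ⊥-elim (∉-∅ i j h))

  insert-isMatching : ∀ M {u v} → IsMatching G M → Adj G u v → ¬ Covered M u → ¬ Covered M v →
                      IsMatching G (insert u v M)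
  insert-isMatching M {u} {v} (M-sym , M⊆G , M-fun) uv ¬u ¬v = M'-sym , M'⊆G , M'-fun
    where
    M' : EdgeSet n
    M' = insert u v M
    M'-sym : ∀ i j → M' ∋[ i , j ] → M' ∋[ j , i ]
    M'-sym i j h with ∈-insert⁻ u v M h
    ... | inj₁ e = ∈-insert⁺ˡ u v M (SameEdge-sym e)
    ... | inj₂ m = ∈-insert⁺ʳ u v M (M-sym i j m)
    M'⊆G : ∀ i j → M' ∋[ i , j ] → Adj G i j
    M'⊆G i j h with ∈-insert⁻ u v M h
    ... | inj₁ (inj₁ (refl , refl)) = uv
    ... | inj₁ (inj₂ (refl , refl)) = adj-sym uv
    ... | inj₂ m = M⊆G i j m
    M'-fun : ∀ i j k → M' ∋[ i , j ] → M' ∋[ i , k ] → j ≡ k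
    M'-fun i j k h h' with ∈-insert⁻ u v M h | ∈-insert⁻ u v M h'
    ... | inj₁ (inj₁ (refl , refl)) | inj₁ (inj₁ (_ , refl)) = refl
    ... | inj₁ (inj₂ (refl , refl)) | inj₁ (inj₂ (_ , refl)) = refl
    ... | inj₁ (inj₁ (refl , refl)) | inj₁ (inj₂ (u≡v , _)) = ⊥-elim (adj⇒≢ uv u≡v)
    ... | inj₁ (inj₂ (refl , refl)) | inj₁ (inj₁ (v≡u , _)) = ⊥-elim (adj⇒≢ uv (sym v≡u))
    ... | inj₁ (inj₁ (refl , refl)) | inj₂ m = ⊥-elim (¬u (k , m))
    ... | inj₁ (inj₂ (refl , refl)) | inj₂ m = ⊥-elim (¬v (k , m))
    ... | inj₂ m | inj₁ (inj₁ (refl , refl)) = ⊥-elim (¬u (j , m))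
    ... | inj₂ m | inj₁ (inj₂ (refl , refl)) = ⊥-elim (¬v (j , m))
    ... | inj₂ m | inj₂ m' = M-fun i j k m m'

  remove-isMatching : ∀ M u v → IsMatching G M → IsMatching G (remove u v M)
  remove-isMatching M u v (M-sym , M⊆G , M-fun) =
      (λ i j h → let ¬e , m = ∈-remove⁻ u v M h in
                 ∈-remove⁺ u v M (λ e → ¬e (SameEdge-sym e)) (M-sym i j m))
    , (λ i j h → M⊆G i j (proj₂ (∈-remove⁻ u v M h)))
    , (λ i j k h h' → M-fun i j k (proj₂ (∈-remove⁻ u v M h)) (proj₂ (∈-remove⁻ u v M h')))

  -- an edge ij of a matching M' ⊇ M has an endpoint matched in M, which M' must match the same way
  dominating⇒maximal : ∀ M → IsMatching G M → Dominating G M → IsMaximalMatching G M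
  dominating⇒maximal M isM@(M-sym , _ , _) dom = isM , λ M' (M'-sym , M'⊆G , M'-fun) M⊆M' i j h →
    [ (λ { (k , m) → subst (λ z → M ∋[ i , z ]) (M'-fun i k j (M⊆M' i k m) h) m })
    , (λ { (k , m) → M-sym j i (subst (λ z → M ∋[ j , z ]) (M'-fun j k i (M⊆M' j k m) (M'-sym i j h)) m) })
    ] (dom i j (M'⊆G i j h))

  maximal⇒dominating : ∀ M → IsMaximalMatching G M → Dominating G M
  maximal⇒dominating M (isM , max) i j ij with covered? M i | covered? M j
  ... | yes ci | _      = inj₁ ci
  ... | no _   | yes cj = inj₂ cj
  ... | no ¬ci | no ¬cj =
    ⊥-elim (¬ci (j , max (insert i j M) (insert-isMatching M isM ij ¬ci ¬cj) (λ _ _ → ∈-insert⁺ʳ i j M)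
                           i j (∈-insert⁺ˡ i j M (inj₁ (refl , refl)))))

  data GreedyStep (i j : Fin n) (M : EdgeSet n) : EdgeSet n → Set where
    inserted : Adj G i j → ¬ Covered M i → ¬ Covered M j → GreedyStep i j M (insert i j M)
    skipped  : (Adj G i j → Covered M i ⊎ Covered M j) → GreedyStep i j M M

  greedyStep : Fin n × Fin n → EdgeSet n → EdgeSet n
  greedyStep (i , j) M with Graph.adj G i j Bool.≟ true | covered? M i | covered? M j
  ... | yes _ | no _ | no _ = insert i j M
  ... | _     | _    | _    = M

  greedyStep-view : ∀ i j M → GreedyStep i j M (greedyStep (i , j) M)
  greedyStep-view i j M with Graph.adj G i j Bool.≟ true | covered? M i | covered? M j
  ... | yes ij | no ¬ci | no ¬cj = inserted ij ¬ci ¬cj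
  ... | yes _  | yes ci | _      = skipped λ _ → inj₁ ci
  ... | yes _  | no _   | yes cj = skipped λ _ → inj₂ cj
  ... | no ¬ij | _      | _      = skipped λ ij → ⊥-elim (¬ij ij)

  greedy : List (Fin n × Fin n) → EdgeSet n → EdgeSet n
  greedy []       M = M
  greedy (p ∷ ps) M = greedy ps (greedyStep p M)

  greedy-isMatching : ∀ ps M → IsMatching G M → IsMatching G (greedy ps M)
  greedy-isMatching []             M isM = isM
  greedy-isMatching ((i , j) ∷ ps) M isM with greedyStep (i , j) M | greedyStep-view i j M
  ... | _ | inserted ij ¬ci ¬cj = greedy-isMatching ps (insert i j M) (insert-isMatching M isM ij ¬ci ¬cj)
  ... | _ | skipped _           = greedy-isMatching ps M isM

  ⊆-greedy : ∀ ps M → M ⊆ₑ greedy ps M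
  ⊆-greedy []             M _ _ m = m
  ⊆-greedy ((i , j) ∷ ps) M with greedyStep (i , j) M | greedyStep-view i j M
  ... | _ | inserted _ _ _ = λ k l m → ⊆-greedy ps (insert i j M) k l (∈-insert⁺ʳ i j M m)
  ... | _ | skipped _      = ⊆-greedy ps M

  ∈-greedy⁻ : ∀ ps M {k l} → greedy ps M ∋[ k , l ] →
              (Σ (Fin n × Fin n) λ (i , j) → (i , j) ∈ ps × SameEdge i j k l) ⊎ M ∋[ k , l ]
  ∈-greedy⁻ []             M m = inj₂ m
  ∈-greedy⁻ ((i , j) ∷ ps) M m with greedyStep (i , j) M | greedyStep-view i j M
  ... | M' | view with ∈-greedy⁻ ps M' m
  ...   | inj₁ (p , p∈ps , e) = inj₁ (p , there p∈ps , e)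
  ...   | inj₂ m' with view
  ...     | skipped _      = inj₂ m'
  ...     | inserted _ _ _ with ∈-insert⁻ i j M m'
  ...       | inj₁ e   = inj₁ ((i , j) , here refl , e)
  ...       | inj₂ m'' = inj₂ m''

  greedy-covers : ∀ ps M {i j} → (i , j) ∈ ps → Adj G i j →
                  Covered (greedy ps M) i ⊎ Covered (greedy ps M) j
  greedy-covers (_ ∷ ps) M {i} {j} (here refl) ij with greedyStep (i , j) M | greedyStep-view i j M
  ... | _ | inserted _ _ _ =
    inj₁ (j , ⊆-greedy ps (insert i j M) i j (∈-insert⁺ˡ i j M (inj₁ (refl , refl))))
  ... | _ | skipped dom    = Data.Sum.map (lift i) (lift j) (dom ij)
    where
    lift : ∀ x → Covered M x → Covered (greedy ps M) x
    lift x (y , m) = y , ⊆-greedy ps M x y m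
  greedy-covers (p ∷ ps) M (there q∈ps) ij = greedy-covers ps (greedyStep p M) q∈ps ij

  allPairs : List (Fin n × Fin n)
  allPairs = cartesianProduct (allFin n) (allFin n)

  extend : EdgeSet n → EdgeSet n
  extend = greedy allPairs

  ⊆-extend : ∀ M → M ⊆ₑ extend M
  ⊆-extend = ⊆-greedy allPairs

  extend-isMaximal : ∀ M → IsMatching G M → IsMaximalMatching G (extend M)
  extend-isMaximal M isM = dominating⇒maximal (extend M) (greedy-isMatching allPairs M isM)
    λ i j → greedy-covers allPairs M (∈-cartesianProduct⁺ (∈-allFin i) (∈-allFin j))

  stays-uncovered : ∀ M K {v} → IsMatching G M → IsMatching G K → M ⊆ₑ K → ¬ Covered M v →
                    (∀ x → Adj G v x → Covered M x) → ¬ Covered K v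
  stays-uncovered M K {v} (M-sym , _ , _) (K-sym , K⊆G , K-fun) M⊆K ¬cv nbrs (x , vx)
    with nbrs x (K⊆G v x vx)
  ... | z , xz with K-fun x z v (M⊆K x z xz) (K-sym v x vx)
  ...   | refl = ¬cv (x , M-sym x v xz)

module _ {n : ℕ} {P : Fin n → Set} (P? : ∀ x → Dec (P x)) (g : Fin n → Fin n) where

  pairsOn : List (Fin n × Fin n)
  pairsOn = map (λ x → x , g x) (filter P? (allFin n))

  ∈-pairsOn⁺ : ∀ {x} → P x → (x , g x) ∈ pairsOn
  ∈-pairsOn⁺ {x} px = ∈-map⁺ (λ x → x , g x) (∈-filter⁺ P? (∈-allFin x) px)

  ∈-pairsOn⁻ : ∀ {q} → q ∈ pairsOn → Σ (Fin n) λ x → P x × q ≡ (x , g x)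
  ∈-pairsOn⁻ q∈ with ∈-map⁻ (λ x → x , g x) q∈
  ... | x , x∈ , refl = x , proj₂ (∈-filter⁻ P? {xs = allFin n} x∈) , refl

module _ {n : ℕ} {P : Fin n → Set} {Q : Fin n → Fin n → Set}
         (P? : ∀ x → Dec (P x)) (pick : ∀ x → P x → Σ (Fin n) (Q x)) where

  choose : Fin n → Fin n
  choose x with P? x
  ... | yes px = proj₁ (pick x px)
  ... | no _   = x

  choose-spec : ∀ {x} → P x → Q x (choose x)
  choose-spec {x} px with P? x
  ... | yes px' = proj₂ (pick x px')
  ... | no ¬px  = ⊥-elim (¬px px)

module MoveLeaf {n : ℕ} (G : Graph n) {b c d : Fin n}
                (b-leaf : ∀ {y} → Adj G b y → y ≡ c) (cd : Adj G c d) (b≢d : b ≢ d) where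

  open Graphs G

  private
    adj' : Fin n → Fin n → Bool
    adj' i j with sameEdge? c b i j | sameEdge? d b i j
    ... | yes _ | _     = false
    ... | no _  | yes _ = true
    ... | no _  | no _  = Graph.adj G i j

    adj'-swap : ∀ i j → adj' i j ≡ adj' j i
    adj'-swap i j with sameEdge? c b i j | sameEdge? d b i j | sameEdge? c b j i | sameEdge? d b j i
    ... | yes _  | _      | yes _  | _      = refl
    ... | yes e  | _      | no ¬e  | _      = ⊥-elim (¬e (SameEdge-sym e))
    ... | no ¬e  | _      | yes e  | _      = ⊥-elim (¬e (SameEdge-sym e))
    ... | no _   | yes _  | no _   | yes _  = refl
    ... | no _   | yes e  | no _   | no ¬e  = ⊥-elim (¬e (SameEdge-sym e))
    ... | no _   | no ¬e  | no _   | yes e  = ⊥-elim (¬e (SameEdge-sym e))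
    ... | no _   | no _   | no _   | no _   = Graph.sym G i j

    adj'-irrefl : ∀ i → adj' i i ≡ false
    adj'-irrefl i with sameEdge? c b i i | sameEdge? d b i i
    ... | yes _ | _                      = refl
    ... | no _  | yes (inj₁ (refl , e)) = ⊥-elim (b≢d (sym e))
    ... | no _  | yes (inj₂ (refl , e)) = ⊥-elim (b≢d e)
    ... | no _  | no _                   = Graph.irrefl G i

  G' : Graph n
  G' = record { adj = adj' ; sym = adj'-swap ; irrefl = adj'-irrefl }

  G'-adj⁻ : ∀ {i j} → Adj G' i j → ¬ SameEdge c b i j × (SameEdge d b i j ⊎ Adj G i j)
  G'-adj⁻ {i} {j} h with sameEdge? c b i j | sameEdge? d b i j
  G'-adj⁻ () | yes _ | _
  ... | no ¬e | yes e = ¬e , inj₁ e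
  ... | no ¬e | no _  = ¬e , inj₂ h

  G'-adj⁺ : ∀ {i j} → ¬ SameEdge c b i j → Adj G i j → Adj G' i j
  G'-adj⁺ {i} {j} ¬e ij with sameEdge? c b i j | sameEdge? d b i j
  ... | yes e | _     = ⊥-elim (¬e e)
  ... | no _  | yes _ = refl
  ... | no _  | no _  = ij

  G'-db : Adj G' d b
  G'-db with sameEdge? c b d b | sameEdge? d b d b
  ... | yes (inj₁ (d≡c , _)) | _ = ⊥-elim (adj⇒≢ cd (sym d≡c))
  ... | yes (inj₂ (d≡b , _)) | _ = ⊥-elim (b≢d (sym d≡b))
  ... | no _ | yes _ = refl
  ... | no _ | no ¬e = ⊥-elim (¬e (inj₁ (refl , refl)))

  G'-leaf : ∀ {y} → Adj G' b y → y ≡ d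
  G'-leaf h with G'-adj⁻ h
  ... | _  , inj₁ (inj₁ (b≡d , _)) = ⊥-elim (b≢d b≡d)
  ... | _  , inj₁ (inj₂ (_ , y≡d)) = y≡d
  ... | ¬e , inj₂ by with b-leaf by
  ...   | refl = ⊥-elim (¬e (inj₂ (refl , refl)))

  G'-isTree : IsTree G → IsTree G'
  G'-isTree (connected , acyclic) = (λ u v → walk' (connected u v)) , acyclic'
    where
    open Graphs G' using () renaming (adj-sym to G'-adj-sym; leaf∉cycle to G'-leaf∉cycle)
    G'-cd : Adj G' c d
    G'-cd = G'-adj⁺ (¬SameEdgeʳ (adj⇒≢ cd ∘ sym) (b≢d ∘ sym)) cd
    walk' : ∀ {u v} → Walk G u v → Walk G' u v
    walk' here = here
    walk' (step {u} {w} uw w⇝v) with sameEdge? c b u w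
    ... | yes (inj₁ (refl , refl)) = step G'-cd (step G'-db (walk' w⇝v))
    ... | yes (inj₂ (refl , refl)) =
      step (G'-adj-sym {d} G'-db) (step (G'-adj-sym {c} G'-cd) (walk' w⇝v))
    ... | no ¬e = step (G'-adj⁺ ¬e uw) (walk' w⇝v)
    acyclic' : Acyclic G'
    acyclic' v ws (2≤ , u , l) = acyclic v ws (2≤ , u , restrict (∷ʳ⁺ b∉ (All.head b∉)) l)
      where
      b∉ : All (b ≢_) (v ∷ ws)
      b∉ = ¬Any⇒All¬ (v ∷ ws) (G'-leaf∉cycle G'-leaf (2≤ , u , l))
      restrict : ∀ {xs} → All (b ≢_) xs → Linked (Adj G') xs → Linked (Adj G) xs
      restrict _ [] = []
      restrict _ [-] = [-]
      restrict (b≢x ∷ b≢y ∷ bs) (xy ∷ l) with G'-adj⁻ xy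
      ... | _ , inj₂ xy' = xy' ∷ restrict (b≢y ∷ bs) l
      ... | _ , inj₁ (inj₁ (_ , refl)) = ⊥-elim (b≢y refl)
      ... | _ , inj₁ (inj₂ (refl , _)) = ⊥-elim (b≢x refl)

module PendantStar {n : ℕ} (T : Graph n) (T-tree : IsTree T) {c a b d : Fin n}
  (ca : Adj T c a) (cb : Adj T c b) (cd : Adj T c d) (a≢b : a ≢ b) (a≢d : a ≢ d) (b≢d : b ≢ d)
  (deg-c : deg T c ≡ 3) (deg-a : deg T a ≡ 1) (deg-b : deg T b ≡ 1) where

  open Graphs T
  open Matchings T

  acyclic : Acyclic T
  acyclic = proj₂ T-tree

  c-neighbour : ∀ {y} → Adj T c y → y ≡ a ⊎ y ≡ b ⊎ y ≡ d
  c-neighbour = deg≡3⇒neighbours deg-c ca cb cd a≢b a≢d b≢d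

  a-leaf : ∀ {y} → Adj T a y → y ≡ c
  a-leaf ay = deg≡1⇒neighbour-unique deg-a ay (adj-sym ca)

  b-leaf : ∀ {y} → Adj T b y → y ≡ c
  b-leaf by = deg≡1⇒neighbour-unique deg-b by (adj-sym cb)

  open MoveLeaf T b-leaf cd b≢d public
    renaming (G' to T'; G'-isTree to T'-isTree; G'-adj⁻ to T'-adj⁻; G'-adj⁺ to T'-adj⁺; G'-db to T'-db)

  open Matchings T' using ()
    renaming (maximal⇒dominating to maximal⇒dominating'; remove-isMatching to remove-isMatching')

  Outer : Fin n → Set
  Outer x = Adj T d x × x ≢ c

  outer? : ∀ x → Dec (Outer x)
  outer? x = (Graph.adj T d x Bool.≟ true) ×-dec ¬? (x ≟ c)

  outer⇒≢d : ∀ {x} → Outer x → x ≢ d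
  outer⇒≢d (dx , _) x≡d = adj⇒≢ dx (sym x≡d)

  outer⇒≢a : ∀ {x} → Outer x → x ≢ a
  outer⇒≢a (da , _) refl = adj⇒≢ cd (sym (a-leaf (adj-sym da)))

  outer⇒≢b : ∀ {x} → Outer x → x ≢ b
  outer⇒≢b (db , _) refl = adj⇒≢ cd (sym (b-leaf (adj-sym db)))

  module MaximalInT' (M : EdgeSet n) (M-max : IsMaximalMatching T' M) where

    M-sym : ∀ i j → M ∋[ i , j ] → M ∋[ j , i ]
    M-sym = proj₁ (proj₁ M-max)
    M⊆T' : ∀ i j → M ∋[ i , j ] → Adj T' i j
    M⊆T' = proj₁ (proj₂ (proj₁ M-max))
    M-fun : ∀ i j k → M ∋[ i , j ] → M ∋[ i , k ] → j ≡ k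
    M-fun = proj₂ (proj₂ (proj₁ M-max))

    c-covered : Covered M c
    c-covered with maximal⇒dominating' M M-max c a (T'-adj⁺ (¬SameEdgeʳ (adj⇒≢ ca ∘ sym) a≢b) ca)
    ... | inj₁ cc = cc
    ... | inj₂ (z , az) with T'-adj⁻ (M⊆T' a z az)
    ...   | _ , inj₁ (inj₁ (a≡d , _)) = ⊥-elim (a≢d a≡d)
    ...   | _ , inj₁ (inj₂ (a≡b , _)) = ⊥-elim (a≢b a≡b)
    ...   | _ , inj₂ az' with a-leaf az'
    ...     | refl = a , M-sym a c az

    cb∉M : ¬ M ∋[ c , b ]
    cb∉M cb∈M = proj₁ (T'-adj⁻ (M⊆T' c b cb∈M)) (inj₁ (refl , refl))

    M⊆T : ∀ {i j} → M ∋[ i , j ] → ¬ SameEdge d b i j → Adj T i j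
    M⊆T {i} {j} ij∈M ¬db with T'-adj⁻ (M⊆T' i j ij∈M)
    ... | _ , inj₁ db = ⊥-elim (¬db db)
    ... | _ , inj₂ ij = ij

    module WithDB (db∈M : M ∋[ d , b ]) where

      d-partner : ∀ {z} → M ∋[ d , z ] → z ≡ b
      d-partner dz = M-fun d _ b dz db∈M

      b-partner : ∀ {z} → M ∋[ b , z ] → z ≡ d
      b-partner bz = M-fun b _ d bz (M-sym d b db∈M)

      ca∈M : M ∋[ c , a ]
      ca∈M with c-covered
      ... | z , cz with T'-adj⁻ (M⊆T' c z cz)
      ...   | _ , inj₁ (inj₁ (c≡d , _)) = ⊥-elim (adj⇒≢ cd c≡d)
      ...   | _ , inj₁ (inj₂ (c≡b , _)) = ⊥-elim (adj⇒≢ cb c≡b)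
      ...   | ¬cb , inj₂ cz' with c-neighbour cz'
      ...     | inj₁ refl        = cz
      ...     | inj₂ (inj₁ refl) = ⊥-elim (¬cb (inj₁ (refl , refl)))
      ...     | inj₂ (inj₂ refl) = ⊥-elim (adj⇒≢ cb (d-partner (M-sym c d cz)))

      c-partner : ∀ {z} → M ∋[ c , z ] → z ≡ a
      c-partner cz = M-fun c _ a cz ca∈M

  Away : Fin n → Set
  Away x = x ≢ a × x ≢ b × x ≢ c × x ≢ d

  outer⇒away : ∀ {x} → Outer x → Away x
  outer⇒away ox = outer⇒≢a ox , outer⇒≢b ox , proj₂ ox , outer⇒≢d ox

  data EdgeOfT (i j : Fin n) : Set where
    touches-c : i ≡ c ⊎ j ≡ c → EdgeOfT i j
    leaves-d  : i ≡ d × Outer j ⊎ j ≡ d × Outer i → EdgeOfT i j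
    away      : Adj T' i j → Away i → Away j → EdgeOfT i j

  edgeOfT : ∀ {i j} → Adj T i j → EdgeOfT i j
  edgeOfT {i} {j} ij with i ≟ c | j ≟ c | i ≟ d | j ≟ d
  ... | yes i≡c | _       | _        | _        = touches-c (inj₁ i≡c)
  ... | no _    | yes j≡c | _        | _        = touches-c (inj₂ j≡c)
  ... | no _    | no j≢c  | yes refl | _        = leaves-d (inj₁ (refl , ij , j≢c))
  ... | no i≢c  | no _    | no _     | yes refl = leaves-d (inj₂ (refl , adj-sym ij , i≢c))
  ... | no i≢c  | no j≢c  | no i≢d   | no j≢d   =
    away (T'-adj⁺ (¬SameEdgeˡ i≢c i≢b) ij) (i≢a , i≢b , i≢c , i≢d) (j≢a , j≢b , j≢c , j≢d)
    where
    i≢a : i ≢ a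
    i≢a refl = j≢c (a-leaf ij)
    i≢b : i ≢ b
    i≢b refl = j≢c (b-leaf ij)
    j≢a : j ≢ a
    j≢a refl = i≢c (a-leaf (adj-sym ij))
    j≢b : j ≢ b
    j≢b refl = i≢c (b-leaf (adj-sym ij))

  strip : EdgeSet n → EdgeSet n
  strip M = remove c a (remove d b M)

  ∈strip⁻ : ∀ M {i j} → strip M ∋[ i , j ] → M ∋[ i , j ] × ¬ SameEdge d b i j × ¬ SameEdge c a i j
  ∈strip⁻ M h = let ¬ca , h₁ = ∈-remove⁻ c a (remove d b M) h
                    ¬db , h₀ = ∈-remove⁻ d b M h₁
                in h₀ , ¬db , ¬ca

  swapped : Fin n → EdgeSet n → EdgeSet n
  swapped y M = insert c b (insert d y (strip M))

  cb∈swapped : ∀ y M → swapped y M ∋[ c , b ]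
  cb∈swapped y M = ∈-insert⁺ˡ c b (insert d y (strip M)) (inj₁ (refl , refl))

  dy∈swapped : ∀ y M → swapped y M ∋[ d , y ]
  dy∈swapped y M =
    ∈-insert⁺ʳ c b (insert d y (strip M)) (∈-insert⁺ˡ d y (strip M) (inj₁ (refl , refl)))

  Covered-swapped : ∀ y M {x} → Away x → Covered M x → Covered (swapped y M) x
  Covered-swapped y M (x≢a , x≢b , x≢c , x≢d) cx =
    Covered-insert c b (insert d y (strip M)) (Covered-insert d y (strip M)
      (Covered-remove c a (remove d b M) (Covered-remove d b M cx x≢d x≢b) x≢c x≢a))

  keep-isMaximal : ∀ M → IsMaximalMatching T' M → ¬ M ∋[ d , b ] → IsMaximalMatching T M
  keep-isMaximal M M-max db∉M =
    dominating⇒maximal M (IsMatching-transfer {T'} M (proj₁ M-max) λ i j ij → M⊆T ij (¬db ij)) dominating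
    where
    open MaximalInT' M M-max
    ¬db : ∀ {i j} → M ∋[ i , j ] → ¬ SameEdge d b i j
    ¬db ij (inj₁ (refl , refl)) = db∉M ij
    ¬db ij (inj₂ (refl , refl)) = db∉M (M-sym b d ij)
    dominating : Dominating T M
    dominating i j ij with sameEdge? c b i j
    ... | yes (inj₁ (refl , refl)) = inj₁ c-covered
    ... | yes (inj₂ (refl , refl)) = inj₂ c-covered
    ... | no ¬cb = maximal⇒dominating' M M-max i j (T'-adj⁺ ¬cb ij)

  swapped-isMatching : ∀ M {y} → IsMaximalMatching T' M → M ∋[ d , b ] → Outer y → ¬ Covered M y →
                       IsMatching T (swapped y M)
  swapped-isMatching M {y} M-max db∈M oy@(dy , y≢c) ¬cy =
    insert-isMatching (insert d y (strip M)) (insert-isMatching (strip M) strip-isMatching dy d-free y-free)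
                      cb c-free b-free
    where
    open MaximalInT' M M-max
    open WithDB db∈M
    strip-isMatching : IsMatching T (strip M)
    strip-isMatching = IsMatching-transfer {T'} (strip M)
      (remove-isMatching' (remove d b M) c a (remove-isMatching' M d b (proj₁ M-max)))
      λ i j h → let h₀ , ¬db , _ = ∈strip⁻ M h in M⊆T h₀ ¬db
    d-free : ¬ Covered (strip M) d
    d-free (z , h) with ∈strip⁻ M h
    ... | h₀ , ¬db , _ with d-partner h₀
    ...   | refl = ¬db (inj₁ (refl , refl))
    y-free : ¬ Covered (strip M) y
    y-free (z , h) = ¬cy (z , proj₁ (∈strip⁻ M h))
    c-free : ¬ Covered (insert d y (strip M)) c
    c-free (z , h) with ∈-insert⁻ d y (strip M) h
    ... | inj₁ (inj₁ (c≡d , _)) = adj⇒≢ cd c≡d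
    ... | inj₁ (inj₂ (c≡y , _)) = y≢c (sym c≡y)
    ... | inj₂ h' with ∈strip⁻ M h'
    ...   | h₀ , _ , ¬ca with c-partner h₀
    ...     | refl = ¬ca (inj₁ (refl , refl))
    b-free : ¬ Covered (insert d y (strip M)) b
    b-free (z , h) with ∈-insert⁻ d y (strip M) h
    ... | inj₁ (inj₁ (b≡d , _)) = b≢d b≡d
    ... | inj₁ (inj₂ (b≡y , _)) = outer⇒≢b oy (sym b≡y)
    ... | inj₂ h' with ∈strip⁻ M h'
    ...   | h₀ , ¬db , _ with b-partner h₀
    ...     | refl = ¬db (inj₂ (refl , refl))

  swapped-isMaximal : ∀ M {y} → IsMaximalMatching T' M → M ∋[ d , b ] → Outer y → ¬ Covered M y →
                      IsMaximalMatching T (swapped y M)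
  swapped-isMaximal M {y} M-max db∈M oy ¬cy =
    dominating⇒maximal (swapped y M) (swapped-isMatching M M-max db∈M oy ¬cy) dominating
    where
    c-covered : Covered (swapped y M) c
    c-covered = b , cb∈swapped y M
    d-covered : Covered (swapped y M) d
    d-covered = y , dy∈swapped y M
    dominating : Dominating T (swapped y M)
    dominating i j ij with edgeOfT ij
    ... | touches-c (inj₁ refl)      = inj₁ c-covered
    ... | touches-c (inj₂ refl)      = inj₂ c-covered
    ... | leaves-d (inj₁ (refl , _)) = inj₁ d-covered
    ... | leaves-d (inj₂ (refl , _)) = inj₂ d-covered
    ... | away ij' ai aj =
      Data.Sum.map (Covered-swapped y M ai) (Covered-swapped y M aj) (maximal⇒dominating' M M-max i j ij')

  drop-isMaximal : ∀ M → IsMaximalMatching T' M → M ∋[ d , b ] → (∀ x → Outer x → Covered M x) →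
                   IsMaximalMatching T (remove d b M)
  drop-isMaximal M M-max db∈M outer-covered = dominating⇒maximal (remove d b M) dropped-isMatching dominating
    where
    open MaximalInT' M M-max
    open WithDB db∈M
    dropped-isMatching : IsMatching T (remove d b M)
    dropped-isMatching = IsMatching-transfer {T'} (remove d b M) (remove-isMatching' M d b (proj₁ M-max))
      λ i j h → let ¬db , h₀ = ∈-remove⁻ d b M h in M⊆T h₀ ¬db
    covered-if-≢d,b : ∀ {x} → x ≢ d → x ≢ b → Covered M x → Covered (remove d b M) x
    covered-if-≢d,b x≢d x≢b cx = Covered-remove d b M cx x≢d x≢b
    dominating : Dominating T (remove d b M)
    dominating i j ij with edgeOfT ij
    ... | touches-c (inj₁ refl)       = inj₁ (covered-if-≢d,b (adj⇒≢ cd) (adj⇒≢ cb) (a , ca∈M))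
    ... | touches-c (inj₂ refl)       = inj₂ (covered-if-≢d,b (adj⇒≢ cd) (adj⇒≢ cb) (a , ca∈M))
    ... | leaves-d (inj₁ (refl , oj)) = inj₂ (covered-if-≢d,b (outer⇒≢d oj) (outer⇒≢b oj) (outer-covered j oj))
    ... | leaves-d (inj₂ (refl , oi)) = inj₁ (covered-if-≢d,b (outer⇒≢d oi) (outer⇒≢b oi) (outer-covered i oi))
    ... | away ij' (_ , i≢b , _ , i≢d) (_ , j≢b , _ , j≢d) =
      Data.Sum.map (covered-if-≢d,b i≢d i≢b) (covered-if-≢d,b j≢d j≢b) (maximal⇒dominating' M M-max i j ij')

  restore : Fin n → EdgeSet n → EdgeSet n
  restore y X = insert d b (insert c a (remove d y (remove c b X)))

  restore-swapped : ∀ M {y} → IsMaximalMatching T' M → M ∋[ d , b ] → Outer y → ¬ Covered M y →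
                    restore y (swapped y M) ≡ M
  restore-swapped M {y} M-max db∈M (_ , y≢c) ¬cy = begin
    insert d b (insert c a (remove d y (remove c b (insert c b (insert d y (strip M))))))
      ≡⟨ cong (λ X → insert d b (insert c a (remove d y X)))
              (remove-insert c b (insert d y (strip M)) (cb∉ ∘ ∈-insert⁻ d y (strip M))
                                                        (bc∉ ∘ ∈-insert⁻ d y (strip M))) ⟩
    insert d b (insert c a (remove d y (insert d y (strip M))))
      ≡⟨ cong (λ X → insert d b (insert c a X))
              (remove-insert d y (strip M) (λ h → ¬cy (d , M-sym d y (proj₁ (∈strip⁻ M h))))
                                           (λ h → ¬cy (d , proj₁ (∈strip⁻ M h)))) ⟩
    insert d b (insert c a (strip M))
      ≡⟨ cong (insert d b) (insert-remove c a (remove d b M)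
                              (∈-remove⁺ d b M (¬SameEdgeˡ (adj⇒≢ cd) (adj⇒≢ cb)) ca∈M)
                              (∈-remove⁺ d b M (¬SameEdgeˡ a≢d a≢b) (M-sym c a ca∈M))) ⟩
    insert d b (remove d b M)
      ≡⟨ insert-remove d b M db∈M (M-sym d b db∈M) ⟩
    M ∎
    where
    open MaximalInT' M M-max
    open WithDB db∈M
    cb∉ : ¬ (SameEdge d y c b ⊎ strip M ∋[ c , b ])
    cb∉ (inj₁ (inj₁ (c≡d , _))) = adj⇒≢ cd c≡d
    cb∉ (inj₁ (inj₂ (c≡y , _))) = y≢c (sym c≡y)
    cb∉ (inj₂ h)                = cb∉M (proj₁ (∈strip⁻ M h))
    bc∉ : ¬ (SameEdge d y b c ⊎ strip M ∋[ b , c ])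
    bc∉ (inj₁ (inj₁ (b≡d , _))) = b≢d b≡d
    bc∉ (inj₁ (inj₂ (_ , c≡d))) = adj⇒≢ cd c≡d
    bc∉ (inj₂ h)                = cb∉M (M-sym b c (proj₁ (∈strip⁻ M h)))

  keep≢swapped : ∀ {M} y M' → IsMaximalMatching T' M → M ≢ swapped y M'
  keep≢swapped {M} y M' M-max refl = MaximalInT'.cb∉M M M-max (cb∈swapped y M')

  -- d and b are both free in remove d b M', which thus misses the edge db of T'
  keep≢dropped : ∀ M M' → IsMaximalMatching T' M → IsMaximalMatching T' M' → M' ∋[ d , b ] →
                 M ≢ remove d b M'
  keep≢dropped M M' M-max M'-max db∈M' refl with maximal⇒dominating' M M-max d b T'-db
  ... | inj₁ (z , dz) with ∈-remove⁻ d b M' dz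
  ...   | ¬db , dz' with MaximalInT'.WithDB.d-partner M' M'-max db∈M' dz'
  ...     | refl = ¬db (inj₁ (refl , refl))
  keep≢dropped M M' M-max M'-max db∈M' refl | inj₂ (z , bz) with ∈-remove⁻ d b M' bz
  ...   | ¬db , bz' with MaximalInT'.WithDB.b-partner M' M'-max db∈M' bz'
  ...     | refl = ¬db (inj₂ (refl , refl))

  swapped≢dropped : ∀ y M M' → IsMaximalMatching T' M' → swapped y M ≢ remove d b M'
  swapped≢dropped y M M' M'-max eq =
    MaximalInT'.cb∉M M' M'-max (proj₂ (∈-remove⁻ d b M' (subst (_∋[ c , b ]) eq (cb∈swapped y M))))

  swapped-injective : ∀ M₁ M₂ {y₁ y₂} → IsMaximalMatching T' M₁ → IsMaximalMatching T' M₂ →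
                      M₁ ∋[ d , b ] → M₂ ∋[ d , b ] → Outer y₁ → Outer y₂ →
                      ¬ Covered M₁ y₁ → ¬ Covered M₂ y₂ → swapped y₁ M₁ ≡ swapped y₂ M₂ → M₁ ≡ M₂
  swapped-injective M₁ M₂ {y₁} {y₂} m₁ m₂ db₁ db₂ oy₁ oy₂ ¬cy₁ ¬cy₂ eq with y₁≡y₂
    where
    X-fun : ∀ i j k → swapped y₁ M₁ ∋[ i , j ] → swapped y₁ M₁ ∋[ i , k ] → j ≡ k
    X-fun = proj₂ (proj₂ (swapped-isMatching M₁ m₁ db₁ oy₁ ¬cy₁))
    y₁≡y₂ : y₁ ≡ y₂
    y₁≡y₂ = X-fun d y₁ y₂ (dy∈swapped y₁ M₁) (subst (_∋[ d , y₂ ]) (sym eq) (dy∈swapped y₂ M₂))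
  ... | refl = begin
    M₁                         ≡⟨ sym (restore-swapped M₁ m₁ db₁ oy₁ ¬cy₁) ⟩
    restore y₁ (swapped y₁ M₁) ≡⟨ cong (restore y₁) eq ⟩
    restore y₁ (swapped y₁ M₂) ≡⟨ restore-swapped M₂ m₂ db₂ oy₂ ¬cy₂ ⟩
    M₂                         ∎

  dropped-injective : ∀ M₁ M₂ → IsMaximalMatching T' M₁ → IsMaximalMatching T' M₂ →
                      M₁ ∋[ d , b ] → M₂ ∋[ d , b ] → remove d b M₁ ≡ remove d b M₂ → M₁ ≡ M₂
  dropped-injective M₁ M₂ m₁ m₂ db₁ db₂ eq = begin
    M₁                         ≡⟨ sym (insert-remove d b M₁ db₁ (proj₁ (proj₁ m₁) d b db₁)) ⟩
    insert d b (remove d b M₁) ≡⟨ cong (insert d b) eq ⟩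
    insert d b (remove d b M₂) ≡⟨ insert-remove d b M₂ db₂ (proj₁ (proj₁ m₂) d b db₂) ⟩
    M₂                         ∎

  -- a swap prefers the vertex p whenever p is a free neighbour of d
  module Injection (p : Fin n) where

    data Shape (M : EdgeSet n) : Set where
      keep : ¬ M ∋[ d , b ] → Shape M
      swap : M ∋[ d , b ] → ∀ y → Outer y → ¬ Covered M y → (Outer p → ¬ Covered M p → y ≡ p) → Shape M
      drop : M ∋[ d , b ] → (∀ x → Outer x → Covered M x) → Shape M

    shape : ∀ M → Shape M
    shape M with M ∋?[ d , b ]
    ... | no db∉M = keep db∉M
    ... | yes db∈M with outer? p ×-dec ¬? (covered? M p)
    ...   | yes (op , ¬cp) = swap db∈M p op ¬cp (λ _ _ → refl)
    ...   | no ¬p-free with Finₚ.any? (λ x → outer? x ×-dec ¬? (covered? M x))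
    ...     | yes (y , oy , ¬cy) = swap db∈M y oy ¬cy (λ op ¬cp → ⊥-elim (¬p-free (op , ¬cp)))
    ...     | no ¬free = drop db∈M λ x ox → decidable-stable (covered? M x) λ ¬cx → ¬free (x , ox , ¬cx)

    image : ∀ M → Shape M → EdgeSet n
    image M (keep _)         = M
    image M (swap _ y _ _ _) = swapped y M
    image M (drop _ _)       = remove d b M

    φ : EdgeSet n → EdgeSet n
    φ M = image M (shape M)

    φ-isMaximal : ∀ M → IsMaximalMatching T' M → IsMaximalMatching T (φ M)
    φ-isMaximal M M-max with shape M
    ... | keep db∉M            = keep-isMaximal M M-max db∉M
    ... | swap db∈M y oy ¬cy _ = swapped-isMaximal M M-max db∈M oy ¬cy
    ... | drop db∈M covered    = drop-isMaximal M M-max db∈M covered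

    image-injective : ∀ M₁ M₂ → IsMaximalMatching T' M₁ → IsMaximalMatching T' M₂ →
                      (s₁ : Shape M₁) (s₂ : Shape M₂) → image M₁ s₁ ≡ image M₂ s₂ → M₁ ≡ M₂
    image-injective M₁ M₂ m₁ m₂ (keep _) (keep _) eq = eq
    image-injective M₁ M₂ m₁ m₂ (keep _) (swap _ y₂ _ _ _) eq = ⊥-elim (keep≢swapped y₂ M₂ m₁ eq)
    image-injective M₁ M₂ m₁ m₂ (keep _) (drop db₂ _) eq = ⊥-elim (keep≢dropped M₁ M₂ m₁ m₂ db₂ eq)
    image-injective M₁ M₂ m₁ m₂ (swap _ y₁ _ _ _) (keep _) eq = ⊥-elim (keep≢swapped y₁ M₁ m₂ (sym eq))
    image-injective M₁ M₂ m₁ m₂ (swap db₁ _ oy₁ ¬cy₁ _) (swap db₂ _ oy₂ ¬cy₂ _) eq =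
      swapped-injective M₁ M₂ m₁ m₂ db₁ db₂ oy₁ oy₂ ¬cy₁ ¬cy₂ eq
    image-injective M₁ M₂ m₁ m₂ (swap _ y₁ _ _ _) (drop _ _) eq = ⊥-elim (swapped≢dropped y₁ M₁ M₂ m₂ eq)
    image-injective M₁ M₂ m₁ m₂ (drop db₁ _) (keep _) eq = ⊥-elim (keep≢dropped M₂ M₁ m₂ m₁ db₁ (sym eq))
    image-injective M₁ M₂ m₁ m₂ (drop _ _) (swap _ y₂ _ _ _) eq =
      ⊥-elim (swapped≢dropped y₂ M₂ M₁ m₁ (sym eq))
    image-injective M₁ M₂ m₁ m₂ (drop db₁ _) (drop db₂ _) eq = dropped-injective M₁ M₂ m₁ m₂ db₁ db₂ eq

    φ-injective : ∀ {M₁ M₂} → IsMaximalMatching T' M₁ → IsMaximalMatching T' M₂ → φ M₁ ≡ φ M₂ → M₁ ≡ M₂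
    φ-injective {M₁} {M₂} m₁ m₂ = image-injective M₁ M₂ m₁ m₂ (shape M₁) (shape M₂)

    φ-misses : ∀ W → W ∋[ c , b ] →
               (∀ M y → Outer y → ¬ Covered M y → (Outer p → ¬ Covered M p → y ≡ p) → swapped y M ≢ W) →
               ∀ M → IsMaximalMatching T' M → φ M ≢ W
    φ-misses W cb∈W swapped≢W M M-max with shape M
    ... | keep _                = λ M≡W → MaximalInT'.cb∉M M M-max (subst (_∋[ c , b ]) (sym M≡W) cb∈W)
    ... | swap _ y oy ¬cy y-pref = swapped≢W M y oy ¬cy y-pref
    ... | drop _ _              = λ M≡W →
      MaximalInT'.cb∉M M M-max (proj₂ (∈-remove⁻ d b M (subst (_∋[ c , b ]) (sym M≡W) cb∈W)))

    φ-misses-d-free : ∀ W → W ∋[ c , b ] → ¬ Covered W d → ∀ M → IsMaximalMatching T' M → φ M ≢ W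
    φ-misses-d-free W cb∈W ¬cd =
      φ-misses W cb∈W λ M y _ _ _ eq → ¬cd (y , subst (_∋[ d , y ]) eq (dy∈swapped y M))

    -- a swap that matched d to e would have preferred the free vertex p
    φ-misses-p-free : ∀ W {e} → IsMatching T W → W ∋[ c , b ] → W ∋[ d , e ] → e ≢ p →
                      Outer p → ¬ Covered W p → ∀ M → IsMaximalMatching T' M → φ M ≢ W
    φ-misses-p-free W (_ , _ , W-fun) cb∈W de∈W e≢p op ¬cp = φ-misses W cb∈W λ M y _ _ y-pref eq →
      e≢p (trans (W-fun d _ y de∈W (subst (_∋[ d , y ]) eq (dy∈swapped y M)))
                 (y-pref op λ cp → ¬cp (subst (λ X → Covered X p) eq (Covered-swapped y M (outer⇒away op) cp))))

  S₀ : EdgeSet n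
  S₀ = insert c b ∅

  S₀-isMatching : IsMatching T S₀
  S₀-isMatching =
    insert-isMatching ∅ ∅-isMatching cb (λ { (z , h) → ∉-∅ c z h }) (λ { (z , h) → ∉-∅ b z h })

  cb∈S₀ : S₀ ∋[ c , b ]
  cb∈S₀ = ∈-insert⁺ˡ c b ∅ (inj₁ (refl , refl))

  ∈S₀⁻ : ∀ {i j} → S₀ ∋[ i , j ] → SameEdge c b i j
  ∈S₀⁻ {i} {j} h with ∈-insert⁻ c b ∅ h
  ... | inj₁ e = e
  ... | inj₂ h' = ⊥-elim (∉-∅ i j h')

  S₀-free : ∀ {x} → x ≢ c → x ≢ b → ¬ Covered S₀ x
  S₀-free x≢c x≢b (_ , h) = ¬SameEdgeˡ x≢c x≢b (∈S₀⁻ h)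

  d∉S₀ : ¬ Covered S₀ d
  d∉S₀ = S₀-free (adj⇒≢ cd ∘ sym) (b≢d ∘ sym)

  outer∉S₀ : ∀ {x} → Outer x → ¬ Covered S₀ x
  outer∉S₀ ox = S₀-free (proj₂ ox) (outer⇒≢b ox)

  HasLeaf : Fin n → Set
  HasLeaf x = Σ (Fin n) λ f → Adj T x f × f ≢ d × deg T f ≡ 1

  hasLeaf? : ∀ x → Dec (HasLeaf x)
  hasLeaf? x = Finₚ.any? λ f → (Graph.adj T x f Bool.≟ true) ×-dec ¬? (f ≟ d) ×-dec (deg T f ℕ.≟ 1)

  DFree : EdgeSet n → Set
  DFree W = IsMaximalMatching T W × W ∋[ c , b ] × ¬ Covered W d

  -- every outer vertex x is matched to its pendant leaf ℓ x, or ℓ x is taken, necessarily by x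
  witness-leafy : (∀ x → Outer x → HasLeaf x) → Σ (EdgeSet n) DFree
  witness-leafy leaf-at =
    extend K , extend-isMaximal K K-isMatching , ⊆-extend K c b (⊆-greedy L S₀ c b cb∈S₀) , d∉W
    where
    ℓ : Fin n → Fin n
    ℓ = choose outer? leaf-at
    L : List (Fin n × Fin n)
    L = pairsOn outer? ℓ
    K : EdgeSet n
    K = greedy L S₀
    K-isMatching : IsMatching T K
    K-isMatching = greedy-isMatching L S₀ S₀-isMatching
    d∉K : ¬ Covered K d
    d∉K (z , h) with ∈-greedy⁻ L S₀ h
    ... | inj₂ h₀ = d∉S₀ (z , h₀)
    ... | inj₁ (_ , q∈L , e) with ∈-pairsOn⁻ outer? ℓ q∈L
    ...   | x , ox , refl with e
    ...     | inj₁ (d≡x , _)  = outer⇒≢d ox (sym d≡x)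
    ...     | inj₂ (d≡ℓx , _) = proj₁ (proj₂ (choose-spec outer? leaf-at ox)) (sym d≡ℓx)
    d-neighbours-covered : ∀ x → Adj T d x → Covered K x
    d-neighbours-covered x dx with x ≟ c
    ... | yes refl = b , ⊆-greedy L S₀ c b cb∈S₀
    ... | no x≢c with choose-spec outer? leaf-at (dx , x≢c)
    ...   | xℓ , _ , ℓ-leaf with greedy-covers L S₀ (∈-pairsOn⁺ outer? ℓ (dx , x≢c)) xℓ
    ...     | inj₁ cx = cx
    ...     | inj₂ (z , ℓz)
      with deg≡1⇒neighbour-unique ℓ-leaf (proj₁ (proj₂ K-isMatching) (ℓ x) z ℓz) (adj-sym xℓ)
    ...       | refl = ℓ x , proj₁ K-isMatching (ℓ x) x ℓz
    d∉W : ¬ Covered (extend K) d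
    d∉W = stays-uncovered K (extend K) K-isMatching (proj₁ (extend-isMaximal K K-isMatching)) (⊆-extend K)
            d∉K d-neighbours-covered

  -- a walk from d to a vertex outside a, b, c, d, e must leave this set through e
  sole-outer-has-neighbour : 5 < n → ∀ {e} → Outer e → (∀ x → Outer x → x ≡ e) →
                             Σ (Fin n) λ f → Adj T e f × f ≢ d
  sole-outer-has-neighbour 5<n {e} oe outer≡e =
    leave (walk-exits (_∈ L) (λ x → DecMembership._∈?_ _≟_ x L) (proj₁ T-tree d v) d∈L v∉L)
    where
    L : List (Fin n)
    L = a ∷ b ∷ c ∷ d ∷ e ∷ []
    d∈L : d ∈ L
    d∈L = there (there (there (here refl)))
    c∈L : c ∈ L
    c∈L = there (there (here refl))
    v : Fin n
    v = proj₁ (∃∉ L 5<n)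
    v∉L : v ∉ L
    v∉L = proj₂ (∃∉ L 5<n)
    leave : (Σ (Fin n) λ x → Σ (Fin n) λ y → x ∈ L × ¬ y ∈ L × Adj T x y) →
            Σ (Fin n) λ f → Adj T e f × f ≢ d
    leave (_ , y , here refl , y∉L , ay) = ⊥-elim (y∉L (subst (_∈ L) (sym (a-leaf ay)) c∈L))
    leave (_ , y , there (here refl) , y∉L , by) = ⊥-elim (y∉L (subst (_∈ L) (sym (b-leaf by)) c∈L))
    leave (_ , y , there (there (here refl)) , y∉L , cy) with c-neighbour cy
    ... | inj₁ refl        = ⊥-elim (y∉L (here refl))
    ... | inj₂ (inj₁ refl) = ⊥-elim (y∉L (there (here refl)))
    ... | inj₂ (inj₂ refl) = ⊥-elim (y∉L d∈L)
    leave (_ , y , there (there (there (here refl))) , y∉L , dy) with y ≟ c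
    ... | yes refl = ⊥-elim (y∉L c∈L)
    ... | no y≢c with outer≡e y (dy , y≢c)
    ...   | refl = ⊥-elim (y∉L (there (there (there (there (here refl))))))
    leave (_ , y , there (there (there (there (here refl)))) , y∉L , ey) = y , ey , λ { refl → y∉L d∈L }

  witness-single : 5 < n → ∀ {e} → Outer e → (∀ x → Outer x → x ≡ e) → Σ (EdgeSet n) DFree
  witness-single 5<n {e} oe outer≡e with sole-outer-has-neighbour 5<n oe outer≡e
  ... | f , ef , f≢d =
    extend S , extend-isMaximal S S-isMatching , ⊆-extend S c b (∈-insert⁺ʳ e f S₀ cb∈S₀) , d∉W
    where
    S : EdgeSet n
    S = insert e f S₀
    f≢c : f ≢ c
    f≢c refl with c-neighbour (adj-sym ef)
    ... | inj₁ e≡a        = outer⇒≢a oe e≡a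
    ... | inj₂ (inj₁ e≡b) = outer⇒≢b oe e≡b
    ... | inj₂ (inj₂ e≡d) = outer⇒≢d oe e≡d
    f≢b : f ≢ b
    f≢b refl = proj₂ oe (b-leaf (adj-sym ef))
    S-isMatching : IsMatching T S
    S-isMatching = insert-isMatching S₀ S₀-isMatching ef (outer∉S₀ oe) (S₀-free f≢c f≢b)
    d∉S : ¬ Covered S d
    d∉S (z , h) with ∈-insert⁻ e f S₀ h
    ... | inj₁ (inj₁ (d≡e , _)) = outer⇒≢d oe (sym d≡e)
    ... | inj₁ (inj₂ (d≡f , _)) = f≢d (sym d≡f)
    ... | inj₂ h₀               = d∉S₀ (z , h₀)
    d-neighbours-covered : ∀ x → Adj T d x → Covered S x
    d-neighbours-covered x dx with x ≟ c
    ... | yes refl = b , ∈-insert⁺ʳ e f S₀ cb∈S₀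
    ... | no x≢c with outer≡e x (dx , x≢c)
    ...   | refl = f , ∈-insert⁺ˡ x f S₀ (inj₁ (refl , refl))
    d∉W : ¬ Covered (extend S) d
    d∉W = stays-uncovered S (extend S) S-isMatching (proj₁ (extend-isMaximal S S-isMatching)) (⊆-extend S)
            d∉S d-neighbours-covered

  -- d is matched to e; each neighbour x ≠ d of p is matched to x or to a neighbour g x ≠ p, which by
  -- acyclicity can only be taken by x itself
  module PairWitness {p e : Fin n} (op : Outer p) (¬leaf : ¬ HasLeaf p) (oe : Outer e) (e≢p : e ≢ p) where

    Beyond : Fin n → Set
    Beyond x = Adj T p x × x ≢ d

    beyond? : ∀ x → Dec (Beyond x)
    beyond? x = (Graph.adj T p x Bool.≟ true) ×-dec ¬? (x ≟ d)

    another-neighbour : ∀ x → Beyond x → Σ (Fin n) λ y → Adj T x y × y ≢ p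
    another-neighbour x (px , x≢d) =
      deg≢1⇒another-neighbour (λ deg≡1 → ¬leaf (x , px , x≢d , deg≡1)) (adj-sym px)

    g : Fin n → Fin n
    g = choose beyond? another-neighbour

    g-spec : ∀ {x} → Beyond x → Adj T x (g x) × g x ≢ p
    g-spec = choose-spec beyond? another-neighbour

    S : EdgeSet n
    S = insert d e S₀

    de∈S : S ∋[ d , e ]
    de∈S = ∈-insert⁺ˡ d e S₀ (inj₁ (refl , refl))

    L : List (Fin n × Fin n)
    L = pairsOn beyond? g

    K : EdgeSet n
    K = greedy L S

    K-isMatching : IsMatching T K
    K-isMatching = greedy-isMatching L S (insert-isMatching S₀ S₀-isMatching (proj₁ oe) d∉S₀ (outer∉S₀ oe))

    p∉K : ¬ Covered K p
    p∉K (z , h) with ∈-greedy⁻ L S h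
    ... | inj₁ (_ , q∈L , pz) with ∈-pairsOn⁻ beyond? g q∈L
    ...   | x , bx , refl with pz
    ...     | inj₁ (p≡x , _)  = adj⇒≢ (proj₁ bx) p≡x
    ...     | inj₂ (p≡gx , _) = proj₂ (g-spec bx) (sym p≡gx)
    p∉K (z , h) | inj₂ h' with ∈-insert⁻ d e S₀ h'
    ...   | inj₁ (inj₁ (p≡d , _)) = outer⇒≢d op p≡d
    ...   | inj₁ (inj₂ (p≡e , _)) = e≢p (sym p≡e)
    ...   | inj₂ h₀               = outer∉S₀ op (z , h₀)

    g∉S : ∀ {x} → Beyond x → ¬ Covered S (g x)
    g∉S {x} bx@(px , x≢d) (z , h) with g-spec bx | ∈-insert⁻ d e S₀ h
    ... | xg , _ | inj₁ (inj₁ (g≡d , _)) = triangle-free acyclic px (subst (Adj T x) g≡d xg) (proj₁ op)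
    ... | xg , _ | inj₁ (inj₂ (g≡e , _)) =
      square-free acyclic (proj₁ op) px (subst (Adj T x) g≡e xg) (adj-sym (proj₁ oe)) (x≢d ∘ sym) (e≢p ∘ sym)
    ... | xg , _ | inj₂ h₀ with ∈S₀⁻ h₀
    ...   | inj₁ (g≡c , _) =
      [ (λ { refl → proj₂ op (a-leaf (adj-sym px)) }) , [ (λ { refl → proj₂ op (b-leaf (adj-sym px)) }) , x≢d ] ]
        (c-neighbour (adj-sym (subst (Adj T x) g≡c xg)))
    ...   | inj₂ (g≡b , _) with b-leaf (adj-sym (subst (Adj T x) g≡b xg))
    ...     | refl = [ outer⇒≢a op , [ outer⇒≢b op , outer⇒≢d op ] ] (c-neighbour (adj-sym px))

    -- another taker of g x would close a triangle or a square through p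
    g-partner : ∀ {x z} → Beyond x → K ∋[ g x , z ] → z ≡ x
    g-partner {x} bx h with ∈-greedy⁻ L S h
    ... | inj₂ h' = ⊥-elim (g∉S bx (_ , h'))
    ... | inj₁ (_ , q∈L , e') with ∈-pairsOn⁻ beyond? g q∈L | g-spec bx
    ...   | x' , bx' , refl | xg , g≢p with e'
    ...     | inj₁ (gx≡x' , _) =
      ⊥-elim (triangle-free acyclic (proj₁ bx) (subst (Adj T x) gx≡x' xg) (adj-sym (proj₁ bx')))
    ...     | inj₂ (gx≡gx' , z≡x') with x' ≟ x
    ...       | yes refl = z≡x'
    ...       | no x'≢x =
      ⊥-elim (square-free acyclic (proj₁ bx) xg (subst (λ w → Adj T w x') (sym gx≡gx') (adj-sym (proj₁ (g-spec bx'))))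
                                  (adj-sym (proj₁ bx')) (g≢p ∘ sym) (x'≢x ∘ sym))

    p-neighbours-covered : ∀ x → Adj T p x → Covered K x
    p-neighbours-covered x px with x ≟ d
    ... | yes refl = e , ⊆-greedy L S d e de∈S
    ... | no x≢d with greedy-covers L S (∈-pairsOn⁺ beyond? g (px , x≢d)) (proj₁ (g-spec (px , x≢d)))
    ...   | inj₁ cx = cx
    ...   | inj₂ (z , gz) with g-partner (px , x≢d) gz
    ...     | refl = g x , proj₁ K-isMatching (g x) x gz

    W : EdgeSet n
    W = extend K

    W-isMaximal : IsMaximalMatching T W
    W-isMaximal = extend-isMaximal K K-isMatching

    cb∈W : W ∋[ c , b ]
    cb∈W = ⊆-extend K c b (⊆-greedy L S c b (∈-insert⁺ʳ d e S₀ cb∈S₀))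

    de∈W : W ∋[ d , e ]
    de∈W = ⊆-extend K d e (⊆-greedy L S d e de∈S)

    p∉W : ¬ Covered W p
    p∉W = stays-uncovered K W K-isMatching (proj₁ W-isMaximal) (⊆-extend K) p∉K p-neighbours-covered

  Ψ<-of-d-free : Σ (EdgeSet n) DFree → Ψ T' < Ψ T
  Ψ<-of-d-free (W , W-max , cb∈W , ¬cd) =
    Ψ<Ψ-by-injection φ φ-isMaximal φ-injective W W-max (φ-misses-d-free W cb∈W ¬cd)
    where open Injection c

  Ψ-decreases : 5 < n → Ψ T' < Ψ T
  Ψ-decreases 5<n with Finₚ.any? (λ x → outer? x ×-dec ¬? (hasLeaf? x))
  ... | no ¬leafless =
    Ψ<-of-d-free (witness-leafy λ x ox → decidable-stable (hasLeaf? x) λ ¬hl → ¬leafless (x , ox , ¬hl))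
  ... | yes (p , op , ¬hl) with Finₚ.any? (λ x → outer? x ×-dec ¬? (x ≟ p))
  ...   | no ¬other =
    Ψ<-of-d-free (witness-single 5<n op λ x ox → decidable-stable (x ≟ p) λ x≢p → ¬other (x , ox , x≢p))
  ...   | yes (e , oe , e≢p) =
    Ψ<Ψ-by-injection φ φ-isMaximal φ-injective W W-isMaximal
      (φ-misses-p-free W (proj₁ W-isMaximal) cb∈W de∈W e≢p op p∉W)
    where
    open Injection p
    open PairWitness op ¬hl oe e≢p

lemma3p10 : (n : ℕ) → 8 ≤ n → (T : Graph n) → IsTree T → HasPendantStar3 T →
    Σ (Graph n) (λ T' → IsTree T' × Ψ T' < Ψ T)
lemma3p10 n 8≤n T T-tree (c , a , b , d , ca , cb , cd , a≢b , a≢d , b≢d , deg-c , deg-a , deg-b) =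
  T' , T'-isTree T-tree , Ψ-decreases (≤-trans (m≤m+n 6 2) 8≤n)
  where open PendantStar T T-tree ca cb cd a≢b a≢d b≢d deg-c deg-a deg-b
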